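{- Let $G=(R,C,K)$ be an EM-grid with $1\le K\le C$, and let $\overline{R}=\lceil R/2\rceil$, $\overline{C}=\lceil C/2\rceil$, $\overline{K}=\lceil K/2\rceil$. For $i\in\{1,\dots,C\}$ let $\overline{\mathcal{C}}(i)=\mathcal{C}(G,(\overline{R},i))$, where $\mathcal{C}(G,u)=2\sum_{v\in G}d(v,u)$. Let $c\in\{\overline{K},\dots,K\}$ satisfy $\overline{\mathcal{C}}(c)=\min_{i\in[\overline{K},K]}\overline{\mathcal{C}}(i)$, and let $c'\in\{\overline{K},\dots,\overline{C}\}$ satisfy $\overline{\mathcal{C}}(c')=\min_{i\in[\overline{K},\overline{C}]}\overline{\mathcal{C}}(i)$. Define $$c^*=\begin{cases} c & \text{if } K\le\overline{C} \text{ and } \overline{\mathcal{C}}(c)<\overline{\mathcal{C}}(\overline{C}),\\ \overline{C} & \text{if } K\le\overline{C} \text{ and } \overline{\mathcal{C}}(c)\ge\overline{\mathcal{C}}(\overline{C}),\\ c' & \text{otherwise.}\end{cases}$$ Then $u^*=(\overline{R},c^*)$ is a median of $G$, i.e., $\mathcal{C}(G,u^*)=\min_{u\in G}\mathcal{C}(G,u)$.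
   Context: The EM-grid $G=(R,C,K)$ has vertex set $\{1,\dots,R\}\times\{1,\dots,C\}$ (pairs (row, column)); Euclidean part $E=\{1,\dots,R\}\times\{1,\dots,K\}$, border $B=\{1,\dots,R\}\times\{K\}\subseteq E$, Manhattan part $M=\{1,\dots,R\}\times\{K+1,\dots,C\}$. With $d_E(u,v)=\sqrt{(r_u-r_v)^2+(c_u-c_v)^2}$ and $d_M(u,v)=|r_u-r_v|+|c_u-c_v|$: $d(u,v)=d_E(u,v)$ if $u,v\in E$; $d(u,v)=d_M(u,v)$ if $u,v\in M\cup B$; $d(u,v)=d_E(u,h)+d_M(h,v)$ with $h=(r_v,K)$ if $u\in E,v\in M$; $d(u,v)=d_M(u,h)+d_E(h,v)$ with $h=(r_u,K)$ if $u\in M,v\in E$. A median of $G$ is a vertex minimizing $\mathcal{C}(G,\cdot)$ over $G$. -}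

module Defs where

open import Data.Nat using (ℕ; zero; suc; _+_; _*_; _∸_; _^_; _≤_; _<_; _≤?_; ⌈_/2⌉; ∣_-_∣)
open import Data.Bool using (Bool; true; false; if_then_else_; _∧_)
open import Data.List using (List; []; _∷_; map; upTo; concatMap; _++_)
open import Data.Nat.ListAction using (sum)
open import Data.Product using (_×_; _,_; ∃-syntax)
open import Relation.Nullary.Decidable using (⌊_⌋)

-- Exact real arithmetic for the only kind of real numbers that occur:
-- finite sums  Σ_i (√ aᵢ + mᵢ)  with aᵢ, mᵢ ∈ ℕ.
-- A value is represented by the list of pairs (aᵢ , mᵢ).

SqrtSum : Set
SqrtSum = List (ℕ × ℕ)

sqrtBelow : ℕ → ℕ → ℕ
sqrtBelow n zero    = zero
sqrtBelow n (suc b) = if ⌊ suc b * suc b ≤? n ⌋ then suc b else sqrtBelow n b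

isqrt : ℕ → ℕ
isqrt n = sqrtBelow n n

-- Dyadic lower / upper approximations of 2^k · (value):
--   lower k x ≤ 2^k · x ≤ upper k x, and both are within length x of 2^k · x.
lower : ℕ → SqrtSum → ℕ
lower k xs = sum (map (λ { (a , m) → isqrt (a * 4 ^ k) + m * 2 ^ k }) xs)

upper : ℕ → SqrtSum → ℕ
upper k xs = sum (map (λ { (a , m) → suc (isqrt (a * 4 ^ k)) + m * 2 ^ k }) xs)

-- the real order on values: x ≤ y  iff  every lower approximation of x
-- is below the corresponding upper approximation of y
_≤ʳ_ : SqrtSum → SqrtSum → Set
x ≤ʳ y = ∀ k → lower k x ≤ upper k y

_<ʳ_ : SqrtSum → SqrtSum → Set
x <ʳ y = ∃[ k ] (upper k x < lower k y)

infix 4 _≤ʳ_ _<ʳ_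

Vertex : Set
Vertex = ℕ × ℕ

range1 : ℕ → List ℕ
range1 n = map suc (upTo n)

vertices : ℕ → ℕ → List Vertex
vertices R C = concatMap (λ r → map (λ c → (r , c)) (range1 C)) (range1 R)

InGrid : ℕ → ℕ → Vertex → Set
InGrid R C (r , c) = (1 ≤ r × r ≤ R) × (1 ≤ c × c ≤ C)

sq : ℕ → ℕ
sq n = n * n

-- d(u , v) of the EM-grid with border column K, as a pair (a , m)
-- meaning √a + m.
--  * u, v ∈ E               : d_E(u,v)                      = √(Δr² + Δc²)
--  * u, v ∈ M ∪ B           : d_M(u,v)                      = |Δr| + |Δc|
--  * u ∈ E, v ∈ M, h=(r_v,K): d_E(u,h) + d_M(h,v)           = √(Δr² + (c_u-K)²) + (c_v - K)
--  * u ∈ M, v ∈ E, h=(r_u,K): d_M(u,h) + d_E(h,v)           = (c_u - K) + √(Δr² + (K-c_v)²)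
dist : ℕ → Vertex → Vertex → ℕ × ℕ
dist K (ru , cu) (rv , cv) =
  if ⌊ cu ≤? K ⌋ ∧ ⌊ cv ≤? K ⌋
  then (sq ∣ ru - rv ∣ + sq ∣ cu - cv ∣ , 0)
  else if ⌊ K ≤? cu ⌋ ∧ ⌊ K ≤? cv ⌋
  then (0 , ∣ ru - rv ∣ + ∣ cu - cv ∣)
  else if ⌊ cu ≤? K ⌋
  then (sq ∣ ru - rv ∣ + sq ∣ cu - K ∣ , ∣ cv - K ∣)
  else (sq ∣ ru - rv ∣ + sq ∣ K - cv ∣ , ∣ cu - K ∣)

cost : ℕ → ℕ → ℕ → Vertex → SqrtSum
cost R C K u = xs ++ xs
  where xs = map (λ v → dist K v u) (vertices R C)

IsMedian : ℕ → ℕ → ℕ → Vertex → Set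
IsMedian R C K u = InGrid R C u × (∀ v → InGrid R C v → cost R C K u ≤ʳ cost R C K v)

costBar : ℕ → ℕ → ℕ → ℕ → SqrtSum
costBar R C K i = cost R C K (⌈ R /2⌉ , i)

IsArgMin : ℕ → ℕ → ℕ → ℕ → ℕ → ℕ → Set
IsArgMin R C K lo hi c =
  (lo ≤ c × c ≤ hi) × (∀ i → lo ≤ i → i ≤ hi → costBar R C K c ≤ʳ costBar R C K i)

-- Every cost is a finite sum of terms √a + m. Two such sums are compared through their dyadic lower
-- approximations, and agreeing up to a bounded additive error (_≼_) is as good as the real order.
-- A distance depends on the rows only through their offset and grows with it, so in every column
-- the cost is smallest in the middle row ⌈R/2⌉. Along that row the cost 𝒞̄ decreases on [1, ⌈K/2⌉]
-- and on [K, ⌈C/2⌉] and increases from max(K, ⌈C/2⌉) on; when ⌈C/2⌉ < K it increases on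
-- [⌈C/2⌉, K] as well, and this is the one place where the convexity of x ↦ √(t² + x²) is needed.
-- Hence 𝒞̄ attains its minimum among the candidate columns c, ⌈C/2⌉ and c′ of the statement.

module Submission where

open import Defs
open import Data.Nat
open import Data.Nat.Properties
open import Data.Nat.Tactic.RingSolver using (solve-∀)
open import Data.List using (List; []; _∷_; _++_; length; map; applyUpTo; concatMap)
open import Data.List.Properties using (map-++; map-∘)
open import Data.Product using (_×_; _,_; proj₁; proj₂)
open import Data.Sum using ([_,_]′; inj₁; inj₂)
open import Relation.Nullary using (yes; no)
open import Relation.Nullary.Negation using (contradiction)
open import Relation.Binary.PropositionalEquality

-- Integer square roots

m*m<n*n⇒m<n : ∀ {m n} → m * m < n * n → m < n
m*m<n*n⇒m<n p = ≰⇒> λ n≤m → <⇒≱ p (*-mono-≤ n≤m n≤m)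

m*m≤n*n⇒m≤n : ∀ {m n} → m * m ≤ n * n → m ≤ n
m*m≤n*n⇒m≤n p = ≮⇒≥ λ n<m → <⇒≱ (*-mono-< n<m n<m) p

sqrtBelow²≤ : ∀ n b → sqrtBelow n b * sqrtBelow n b ≤ n
sqrtBelow²≤ n zero    = z≤n
sqrtBelow²≤ n (suc b) with suc b * suc b ≤? n
... | yes b²≤n = b²≤n
... | no  _    = sqrtBelow²≤ n b

≤sqrtBelow : ∀ n b {m} → m ≤ b → m * m ≤ n → m ≤ sqrtBelow n b
≤sqrtBelow n zero    m≤b _ = m≤b
≤sqrtBelow n (suc b) m≤b m²≤n with suc b * suc b ≤? n | m≤n⇒m<n∨m≡n m≤b
... | yes _  | _              = m≤b
... | no  _  | inj₁ m<1+b     = ≤sqrtBelow n b (s≤s⁻¹ m<1+b) m²≤n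
... | no  ¬p | inj₂ refl      = contradiction m²≤n ¬p

isqrt[n]²≤n : ∀ n → isqrt n * isqrt n ≤ n
isqrt[n]²≤n n = sqrtBelow²≤ n n

m²≤n⇒m≤isqrt[n] : ∀ {m n} → m * m ≤ n → m ≤ isqrt n
m²≤n⇒m≤isqrt[n] {zero}  _    = z≤n
m²≤n⇒m≤isqrt[n] {suc m} m²≤n = ≤sqrtBelow _ _ (≤-trans (m≤m*n (suc m) (suc m)) m²≤n) m²≤n

n<[1+isqrt[n]]² : ∀ n → n < suc (isqrt n) * suc (isqrt n)
n<[1+isqrt[n]]² n = ≰⇒> λ le → <-irrefl refl (m²≤n⇒m≤isqrt[n] le)

isqrt-mono-≤ : ∀ {m n} → m ≤ n → isqrt m ≤ isqrt n
isqrt-mono-≤ m≤n = m²≤n⇒m≤isqrt[n] (≤-trans (isqrt[n]²≤n _) m≤n)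

isqrt[m*m]≡m : ∀ m → isqrt (m * m) ≡ m
isqrt[m*m]≡m m = ≤-antisym (m*m≤n*n⇒m≤n (isqrt[n]²≤n (m * m))) (m²≤n⇒m≤isqrt[n] ≤-refl)

m*isqrt[n]≤isqrt[m*m*n] : ∀ m n → m * isqrt n ≤ isqrt (m * m * n)
m*isqrt[n]≤isqrt[m*m*n] m n = m²≤n⇒m≤isqrt[n] (begin
  m * isqrt n * (m * isqrt n)   ≡⟨ interchange m (isqrt n) ⟩
  m * m * (isqrt n * isqrt n)   ≤⟨ *-monoʳ-≤ (m * m) (isqrt[n]²≤n n) ⟩
  m * m * n                     ∎)
  where
  open ≤-Reasoning
  interchange : ∀ x y → x * y * (x * y) ≡ x * x * (y * y)
  interchange = solve-∀

isqrt[m*m*n]<m*[1+isqrt[n]] : ∀ m n .{{_ : NonZero m}} → isqrt (m * m * n) < m * suc (isqrt n)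
isqrt[m*m*n]<m*[1+isqrt[n]] m n = m*m<n*n⇒m<n (begin-strict
  isqrt (m * m * n) * isqrt (m * m * n)   ≤⟨ isqrt[n]²≤n (m * m * n) ⟩
  m * m * n                               <⟨ *-monoʳ-< (m * m) {{m*n≢0 m m}} (n<[1+isqrt[n]]² n) ⟩
  m * m * (suc q * suc q)                 ≡⟨ interchange m (suc q) ⟩
  m * suc q * (m * suc q)                 ∎)
  where
  open ≤-Reasoning
  q : ℕ
  q = isqrt n
  interchange : ∀ x y → x * x * (y * y) ≡ x * y * (x * y)
  interchange = solve-∀

-- Comparing sums of square roots

approx : ℕ → ℕ × ℕ → ℕ
approx k (a , m) = isqrt (a * 4 ^ k) + m * 2 ^ k

lower-∷ : ∀ k x xs → lower k (x ∷ xs) ≡ approx k x + lower k xs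
lower-∷ k (a , m) xs = refl

lower-++ : ∀ k xs ys → lower k (xs ++ ys) ≡ lower k xs + lower k ys
lower-++ k []       ys = refl
lower-++ k (x ∷ xs) ys = begin
  lower k (x ∷ xs ++ ys)                    ≡⟨ lower-∷ k x (xs ++ ys) ⟩
  approx k x + lower k (xs ++ ys)           ≡⟨ cong (approx k x +_) (lower-++ k xs ys) ⟩
  approx k x + (lower k xs + lower k ys)    ≡⟨ +-assoc (approx k x) _ _ ⟨
  approx k x + lower k xs + lower k ys      ≡⟨ cong (_+ lower k ys) (lower-∷ k x xs) ⟨
  lower k (x ∷ xs) + lower k ys             ∎
  where open ≡-Reasoning

upper≡lower+length : ∀ k xs → upper k xs ≡ lower k xs + length xs
upper≡lower+length k []             = refl
upper≡lower+length k ((a , m) ∷ xs) =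
  trans (cong (suc (isqrt (a * 4 ^ k)) + m * 2 ^ k +_) (upper≡lower+length k xs))
        (move-suc (isqrt (a * 4 ^ k)) (m * 2 ^ k) (lower k xs) (length xs))
  where
  move-suc : ∀ p q r s → suc p + q + (r + s) ≡ p + q + r + suc s
  move-suc = solve-∀

lower≤upper : ∀ k xs → lower k xs ≤ upper k xs
lower≤upper k xs = ≤-trans (m≤m+n (lower k xs) (length xs)) (≤-reflexive (sym (upper≡lower+length k xs)))

4^k≡2^k*2^k : ∀ k → 4 ^ k ≡ 2 ^ k * 2 ^ k
4^k≡2^k*2^k zero    = refl
4^k≡2^k*2^k (suc k) = trans (cong (4 *_) (4^k≡2^k*2^k k)) (double-square (2 ^ k))
  where
  double-square : ∀ x → 4 * (x * x) ≡ 2 * x * (2 * x)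
  double-square = solve-∀

a*4^[k+j] : ∀ a k j → a * 4 ^ (k + j) ≡ 2 ^ j * 2 ^ j * (a * 4 ^ k)
a*4^[k+j] a k j = begin
  a * 4 ^ (k + j)            ≡⟨ cong (a *_) (^-distribˡ-+-* 4 k j) ⟩
  a * (4 ^ k * 4 ^ j)        ≡⟨ cong (λ z → a * (4 ^ k * z)) (4^k≡2^k*2^k j) ⟩
  a * (4 ^ k * (P * P))      ≡⟨ rearrange a (4 ^ k) P ⟩
  P * P * (a * 4 ^ k)        ∎
  where
  open ≡-Reasoning
  P : ℕ
  P = 2 ^ j
  rearrange : ∀ x y z → x * (y * (z * z)) ≡ z * z * (x * y)
  rearrange = solve-∀

m*2^[k+j] : ∀ m k j → m * 2 ^ (k + j) ≡ 2 ^ j * (m * 2 ^ k)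
m*2^[k+j] m k j = trans (cong (m *_) (^-distribˡ-+-* 2 k j)) (rearrange m (2 ^ k) (2 ^ j))
  where
  rearrange : ∀ x y z → x * (y * z) ≡ z * (x * y)
  rearrange = solve-∀

lower-refine : ∀ k j xs → 2 ^ j * lower k xs ≤ lower (k + j) xs
lower-refine k j []             = ≤-reflexive (*-zeroʳ (2 ^ j))
lower-refine k j ((a , m) ∷ xs) = begin
  P * (isqrt (a * 4 ^ k) + m * 2 ^ k + lower k xs)         ≡⟨ *-distribˡ-+ P _ (lower k xs) ⟩
  P * (isqrt (a * 4 ^ k) + m * 2 ^ k) + P * lower k xs     ≡⟨ cong (_+ P * lower k xs) (*-distribˡ-+ P _ (m * 2 ^ k)) ⟩
  P * isqrt (a * 4 ^ k) + P * (m * 2 ^ k) + P * lower k xs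
    ≤⟨ +-mono-≤ (+-mono-≤ term (≤-reflexive (sym (m*2^[k+j] m k j)))) (lower-refine k j xs) ⟩
  isqrt (a * 4 ^ (k + j)) + m * 2 ^ (k + j) + lower (k + j) xs   ∎
  where
  open ≤-Reasoning
  P : ℕ
  P = 2 ^ j
  term : P * isqrt (a * 4 ^ k) ≤ isqrt (a * 4 ^ (k + j))
  term = subst (λ z → P * isqrt (a * 4 ^ k) ≤ isqrt z) (sym (a*4^[k+j] a k j))
               (m*isqrt[n]≤isqrt[m*m*n] P (a * 4 ^ k))

upper-refine : ∀ k j xs → upper (k + j) xs ≤ 2 ^ j * upper k xs
upper-refine k j []             = z≤n
upper-refine k j ((a , m) ∷ xs) = begin
  suc (isqrt (a * 4 ^ (k + j))) + m * 2 ^ (k + j) + upper (k + j) xs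
    ≤⟨ +-mono-≤ (+-mono-≤ term (≤-reflexive (m*2^[k+j] m k j))) (upper-refine k j xs) ⟩
  P * suc (isqrt (a * 4 ^ k)) + P * (m * 2 ^ k) + P * upper k xs
    ≡⟨ cong (_+ P * upper k xs) (*-distribˡ-+ P _ (m * 2 ^ k)) ⟨
  P * (suc (isqrt (a * 4 ^ k)) + m * 2 ^ k) + P * upper k xs
    ≡⟨ *-distribˡ-+ P _ (upper k xs) ⟨
  P * (suc (isqrt (a * 4 ^ k)) + m * 2 ^ k + upper k xs)   ∎
  where
  open ≤-Reasoning
  P : ℕ
  P = 2 ^ j
  instance _ = m^n≢0 2 j
  term : suc (isqrt (a * 4 ^ (k + j))) ≤ P * suc (isqrt (a * 4 ^ k))
  term = subst (λ z → suc (isqrt z) ≤ P * suc (isqrt (a * 4 ^ k))) (sym (a*4^[k+j] a k j))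
               (isqrt[m*m*n]<m*[1+isqrt[n]] P (a * 4 ^ k))

n<2^n : ∀ n → n < 2 ^ n
n<2^n zero    = z<s
n<2^n (suc n) = begin-strict
  suc n       ≤⟨ n<2^n n ⟩
  2 ^ n       <⟨ m<m+n (2 ^ n) (m^n>0 2 n) ⟩
  2 ^ n + 2 ^ n ≡⟨ cong (2 ^ n +_) (+-identityʳ (2 ^ n)) ⟨
  2 ^ suc n   ∎
  where open ≤-Reasoning

lower-mono-≤ : ∀ xs {k k′} → k ≤ k′ → lower k xs ≤ lower k′ xs
lower-mono-≤ xs {k} {k′} k≤k′ = begin
  lower k xs                 ≤⟨ m≤n*m (lower k xs) (2 ^ j) {{m^n≢0 2 j}} ⟩
  2 ^ j * lower k xs         ≤⟨ lower-refine k j xs ⟩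
  lower (k + j) xs           ≡⟨ cong (λ z → lower z xs) (m+[n∸m]≡n k≤k′) ⟩
  lower k′ xs                ∎
  where
  open ≤-Reasoning
  j : ℕ
  j = k′ ∸ k

record _≼_ (x y : SqrtSum) : Set where
  constructor within
  field
    slack   : ℕ
    bounded : ∀ k → lower k x ≤ lower k y + slack

infix 4 _≼_

≼-refl : ∀ {x} → x ≼ x
≼-refl {x} = within 0 λ k → m≤m+n (lower k x) 0

≼-trans : ∀ {x y z} → x ≼ y → y ≼ z → x ≼ z
≼-trans {x} {y} {z} (within c x≤y) (within d y≤z) = within (d + c) λ k → begin
  lower k x             ≤⟨ x≤y k ⟩
  lower k y + c         ≤⟨ +-monoˡ-≤ c (y≤z k) ⟩
  lower k z + d + c     ≡⟨ +-assoc (lower k z) d c ⟩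
  lower k z + (d + c)   ∎
  where open ≤-Reasoning

≤ʳ⇒≼ : ∀ {x y} → x ≤ʳ y → x ≼ y
≤ʳ⇒≼ {x} {y} x≤y = within (length y) λ k → subst (lower k x ≤_) (upper≡lower+length k y) (x≤y k)

<ʳ⇒≼ : ∀ {x y} → x <ʳ y → x ≼ y
<ʳ⇒≼ {x} {y} (k₀ , x<y) = within (lower k₀ x) λ k → [ below , above ]′ (≤-total k k₀)
  where
  below : ∀ {k} → k ≤ k₀ → lower k x ≤ lower k y + lower k₀ x
  below {k} k≤k₀ = ≤-trans (lower-mono-≤ x k≤k₀) (m≤n+m (lower k₀ x) (lower k y))
  above : ∀ {k} → k₀ ≤ k → lower k x ≤ lower k y + lower k₀ x
  above {k} k₀≤k = ≤-trans (subst (λ z → lower z x ≤ lower z y) (m+[n∸m]≡n k₀≤k) refined) (m≤m+n _ _)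
    where
    open ≤-Reasoning
    j : ℕ
    j = k ∸ k₀
    refined : lower (k₀ + j) x ≤ lower (k₀ + j) y
    refined = begin
      lower (k₀ + j) x    ≤⟨ lower≤upper (k₀ + j) x ⟩
      upper (k₀ + j) x    ≤⟨ upper-refine k₀ j x ⟩
      2 ^ j * upper k₀ x  ≤⟨ *-monoʳ-≤ (2 ^ j) (<⇒≤ x<y) ⟩
      2 ^ j * lower k₀ y  ≤⟨ lower-refine k₀ j y ⟩
      lower (k₀ + j) y    ∎

-- Refining the precision by c bits multiplies the approximations by 2^c and absorbs the slack c < 2^c.
≼⇒≤ʳ : ∀ {x y} → x ≼ y → x ≤ʳ y
≼⇒≤ʳ {x} {y} (within c bounded) k = s≤s⁻¹ (*-cancelˡ-< P (lower k x) (suc (upper k y)) (begin-strict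
  P * lower k x            ≤⟨ lower-refine k c x ⟩
  lower (k + c) x          ≤⟨ bounded (k + c) ⟩
  lower (k + c) y + c      ≤⟨ +-monoˡ-≤ c (lower≤upper (k + c) y) ⟩
  upper (k + c) y + c      ≤⟨ +-monoˡ-≤ c (upper-refine k c y) ⟩
  P * upper k y + c        <⟨ +-monoʳ-< (P * upper k y) (n<2^n c) ⟩
  P * upper k y + P        ≡⟨ +-comm (P * upper k y) P ⟩
  P + P * upper k y        ≡⟨ *-suc P (upper k y) ⟨
  P * suc (upper k y)      ∎))
  where
  open ≤-Reasoning
  P : ℕ
  P = 2 ^ c

-- Convexity of x ↦ √(A + x²)

roots-sum-≤ : ∀ {a b c f p q s t d} →
  a * a ≤ p → b * b ≤ q → s ≤ c * c → t ≤ f * f →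
  s + t ≡ p + q + 2 * d → p * q ≤ (d + c * f) * (d + c * f) → a + b ≤ c + f
roots-sum-≤ {a} {b} {c} {f} {p} {q} {s} {t} {d} a²≤p b²≤q s≤c² t≤f² s+t≡ pq≤ =
  ≮⇒≥ λ c+f<a+b → <-irrefl refl (begin-strict
    (d + c * f) * (d + c * f)   <⟨ *-mono-< (cross c+f<a+b) (cross c+f<a+b) ⟩
    a * b * (a * b)             ≡⟨ interchange a b ⟩
    a * a * (b * b)             ≤⟨ *-mono-≤ a²≤p b²≤q ⟩
    p * q                       ≤⟨ pq≤ ⟩
    (d + c * f) * (d + c * f)   ∎)
  where
  open ≤-Reasoning
  interchange : ∀ x y → x * y * (x * y) ≡ x * x * (y * y)
  interchange = solve-∀
  square-sum : ∀ x y → (x + y) * (x + y) ≡ x * x + y * y + 2 * (x * y)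
  square-sum = solve-∀
  regroup : ∀ x y z w → x + y + 2 * (z + w) ≡ x + y + 2 * z + 2 * w
  regroup = solve-∀
  cross : c + f < a + b → d + c * f < a * b
  cross c+f<a+b = *-cancelˡ-< 2 _ _ (+-cancelˡ-< (p + q) _ _ (begin-strict
    p + q + 2 * (d + c * f)        ≡⟨ regroup p q d (c * f) ⟩
    p + q + 2 * d + 2 * (c * f)    ≡⟨ cong (_+ 2 * (c * f)) s+t≡ ⟨
    s + t + 2 * (c * f)            ≤⟨ +-monoˡ-≤ (2 * (c * f)) (+-mono-≤ s≤c² t≤f²) ⟩
    c * c + f * f + 2 * (c * f)    ≡⟨ square-sum c f ⟨
    (c + f) * (c + f)              <⟨ *-mono-< c+f<a+b c+f<a+b ⟩
    (a + b) * (a + b)              ≡⟨ square-sum a b ⟩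
    a * a + b * b + 2 * (a * b)    ≤⟨ +-monoˡ-≤ (2 * (a * b)) (+-mono-≤ a²≤p b²≤q) ⟩
    p + q + 2 * (a * b)            ∎))

-- At precision k, Euclidean distances √(t² + x²) are approximated by hyp (t * t) (4 ^ k) x.
hyp : ℕ → ℕ → ℕ → ℕ
hyp A N x = isqrt ((A + x * x) * N)

hyp-mono-≤ : ∀ A N {x y} → x ≤ y → hyp A N x ≤ hyp A N y
hyp-mono-≤ A N x≤y = isqrt-mono-≤ (*-monoˡ-≤ N (+-monoʳ-≤ A (*-mono-≤ x≤y x≤y)))

hyp-convex : ∀ A N s d → hyp A N (suc s) + hyp A N (d + s) ≤ hyp A N s + hyp A N (suc (d + s)) + 2
hyp-convex A N s d = subst (hyp A N (suc s) + hyp A N (d + s) ≤_) (move-sucs (hyp A N s) (hyp A N (suc (d + s))))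
  (roots-sum-≤ {hyp A N (suc s)} {hyp A N (d + s)} {c} {f} {d = d * N} (isqrt[n]²≤n P) (isqrt[n]²≤n Q)
               (<⇒≤ (n<[1+isqrt[n]]² S)) (<⇒≤ (n<[1+isqrt[n]]² T)) (sum-identity A N s d) pq≤)
  where
  open ≤-Reasoning
  P : ℕ
  P = (A + suc s * suc s) * N
  Q : ℕ
  Q = (A + (d + s) * (d + s)) * N
  S : ℕ
  S = (A + s * s) * N
  T : ℕ
  T = (A + suc (d + s) * suc (d + s)) * N
  G : ℕ
  G = (A + s * suc (d + s)) * N
  c : ℕ
  c = suc (hyp A N s)
  f : ℕ
  f = suc (hyp A N (suc (d + s)))
  move-sucs : ∀ x y → suc x + suc y ≡ x + y + 2
  move-sucs = solve-∀
  sum-identity : ∀ A N s d → (A + s * s) * N + (A + suc (d + s) * suc (d + s)) * N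
               ≡ (A + suc s * suc s) * N + (A + (d + s) * (d + s)) * N + 2 * (d * N)
  sum-identity = solve-∀
  product-identity : ∀ A N s d → (A + s * s) * N * ((A + suc (d + s) * suc (d + s)) * N)
                   ≡ (A + s * suc (d + s)) * N * ((A + s * suc (d + s)) * N) + A * suc d * suc d * (N * N)
  product-identity = solve-∀
  cross-identity : ∀ A N s d → d * N * (d * N) + 2 * (d * N) * ((A + s * suc (d + s)) * N)
                   + (A + s * s) * N * ((A + suc (d + s) * suc (d + s)) * N)
                 ≡ (A + suc s * suc s) * N * ((A + (d + s) * (d + s)) * N) + 4 * A * d * (N * N)
  cross-identity = solve-∀
  square-sum : ∀ x y → x * x + 2 * x * y + y * y ≡ (x + y) * (x + y)
  square-sum = solve-∀
  ST≤cf² : S * T ≤ c * f * (c * f)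
  ST≤cf² = ≤-trans (*-mono-≤ (<⇒≤ (n<[1+isqrt[n]]² S)) (<⇒≤ (n<[1+isqrt[n]]² T)))
                   (≤-reflexive (interchange c f))
    where
    interchange : ∀ x y → x * x * (y * y) ≡ x * y * (x * y)
    interchange = solve-∀
  G≤cf : G ≤ c * f
  G≤cf = m*m≤n*n⇒m≤n (begin
    G * G                                ≤⟨ m≤m+n (G * G) _ ⟩
    G * G + A * suc d * suc d * (N * N)  ≡⟨ product-identity A N s d ⟨
    S * T                                ≤⟨ ST≤cf² ⟩
    c * f * (c * f)                      ∎)
  pq≤ : P * Q ≤ (d * N + c * f) * (d * N + c * f)
  pq≤ = begin
    P * Q                                                   ≤⟨ m≤m+n (P * Q) _ ⟩
    P * Q + 4 * A * d * (N * N)                             ≡⟨ cross-identity A N s d ⟨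
    d * N * (d * N) + 2 * (d * N) * G + S * T
      ≤⟨ +-mono-≤ (+-monoʳ-≤ (d * N * (d * N)) (*-monoʳ-≤ (2 * (d * N)) G≤cf)) ST≤cf² ⟩
    d * N * (d * N) + 2 * (d * N) * (c * f) + c * f * (c * f) ≡⟨ square-sum (d * N) (c * f) ⟩
    (d * N + c * f) * (d * N + c * f)                       ∎

hyp-convex-iterated : ∀ A N n s d →
  n * hyp A N (suc s) + hyp A N (d + s) ≤ n * hyp A N s + hyp A N (n + d + s) + 2 * n
hyp-convex-iterated A N zero    s d = ≤-reflexive (sym (+-identityʳ _))
hyp-convex-iterated A N (suc n) s d = begin
  X + n * X + h (d + s)                     ≡⟨ regroup₁ X (n * X) (h (d + s)) ⟩
  n * X + (X + h (d + s))                   ≤⟨ +-monoʳ-≤ (n * X) (hyp-convex A N s d) ⟩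
  n * X + (h s + h (suc d + s) + 2)         ≡⟨ regroup₂ (n * X) (h s) (h (suc d + s)) ⟩
  h s + 2 + (n * X + h (suc d + s))         ≤⟨ +-monoʳ-≤ (h s + 2) (hyp-convex-iterated A N n s (suc d)) ⟩
  h s + 2 + (n * h s + h (n + suc d + s) + 2 * n)
    ≡⟨ cong (λ z → h s + 2 + (n * h s + h (z + s) + 2 * n)) (+-suc n d) ⟩
  h s + 2 + (n * h s + h (suc n + d + s) + 2 * n)   ≡⟨ regroup₃ (h s) (n * h s) (h (suc n + d + s)) n ⟩
  h s + n * h s + h (suc n + d + s) + 2 * suc n     ∎
  where
  open ≤-Reasoning
  h : ℕ → ℕ
  h = hyp A N
  X : ℕ
  X = h (suc s)
  regroup₁ : ∀ x y z → x + y + z ≡ y + (x + z)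
  regroup₁ = solve-∀
  regroup₂ : ∀ x y z → x + (y + z + 2) ≡ y + 2 + (x + z)
  regroup₂ = solve-∀
  regroup₃ : ∀ x y z w → x + 2 + (y + z + 2 * w) ≡ x + y + z + 2 * suc w
  regroup₃ = solve-∀

-- Sums over distances

∣m-n∣≤o : ∀ {m n o} → m ≤ o + n → n ≤ o + m → ∣ m - n ∣ ≤ o
∣m-n∣≤o {m} {n} {o} m≤o+n n≤o+m with ∣m-n∣≡[m∸n]∨[n∸m] m n
... | inj₁ eq = subst (_≤ o) (sym eq) (m≤n+o⇒m∸n≤o m n (subst (m ≤_) (+-comm o n) m≤o+n))
... | inj₂ eq = subst (_≤ o) (sym eq) (m≤n+o⇒m∸n≤o n m (subst (n ≤_) (+-comm o m) n≤o+m))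

o+n≤m⇒o≤∣m-n∣ : ∀ {m n o} → o + n ≤ m → o ≤ ∣ m - n ∣
o+n≤m⇒o≤∣m-n∣ {m} {n} {o} o+n≤m =
  subst (o ≤_) (sym (m≤n⇒∣n-m∣≡n∸m (≤-trans (m≤n+m n o) o+n≤m))) (m+n≤o⇒m≤o∸n o o+n≤m)

∣m+n-m∣≡n : ∀ m n → ∣ m + n - m ∣ ≡ n
∣m+n-m∣≡n m n = trans (∣-∣-comm (m + n) m) (∣m-m+n∣≡n m n)

∣1+m+n-m∣≡1+n : ∀ m n → ∣ suc (m + n) - m ∣ ≡ suc n
∣1+m+n-m∣≡1+n m n = trans (cong (∣_- m ∣) (sym (+-suc m n))) (∣m+n-m∣≡n m (suc n))

∣m-1+n∣≤∣m-n∣ : ∀ {m n} → n < m → ∣ m - suc n ∣ ≤ ∣ m - n ∣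
∣m-1+n∣≤∣m-n∣ {m} {n} n<m rewrite m≤n⇒∣n-m∣≡n∸m n<m | m≤n⇒∣n-m∣≡n∸m (<⇒≤ n<m) = ∸-monoʳ-≤ m (n≤1+n n)

∑ : ℕ → (ℕ → ℕ) → ℕ
∑ zero    f = 0
∑ (suc n) f = f 0 + ∑ n (λ a → f (suc a))

∑-last : ∀ n f → ∑ (suc n) f ≡ ∑ n f + f n
∑-last zero    f = +-comm (f 0) 0
∑-last (suc n) f = trans (cong (f 0 +_) (∑-last n (λ a → f (suc a)))) (sym (+-assoc (f 0) _ _))

∑-+ : ∀ m n f → ∑ (m + n) f ≡ ∑ m f + ∑ n (λ a → f (m + a))
∑-+ zero    n f = refl
∑-+ (suc m) n f = trans (cong (f 0 +_) (∑-+ m n (λ a → f (suc a)))) (sym (+-assoc (f 0) _ _))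

∑-cong : ∀ n {f g} → (∀ a → a < n → f a ≡ g a) → ∑ n f ≡ ∑ n g
∑-cong zero    f≡g = refl
∑-cong (suc n) f≡g = cong₂ _+_ (f≡g 0 z<s) (∑-cong n λ a a<n → f≡g (suc a) (s<s a<n))

∑-mono-≤ : ∀ n {f g} → (∀ a → a < n → f a ≤ g a) → ∑ n f ≤ ∑ n g
∑-mono-≤ zero    f≤g = z≤n
∑-mono-≤ (suc n) f≤g = +-mono-≤ (f≤g 0 z<s) (∑-mono-≤ n λ a a<n → f≤g (suc a) (s<s a<n))

∑-distrib-+ : ∀ n f g → ∑ n (λ a → f a + g a) ≡ ∑ n f + ∑ n g
∑-distrib-+ zero    f g = refl
∑-distrib-+ (suc n) f g =
  trans (cong (f 0 + g 0 +_) (∑-distrib-+ n (λ a → f (suc a)) (λ a → g (suc a))))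
        (interchange (f 0) (g 0) _ _)
  where
  interchange : ∀ x y z w → x + y + (z + w) ≡ x + z + (y + w)
  interchange = solve-∀

∑-const : ∀ n x → ∑ n (λ _ → x) ≡ n * x
∑-const zero    x = refl
∑-const (suc n) x = cong (x +_) (∑-const n x)

∑-mono-≤-+ : ∀ n {f g} c → (∀ a → a < n → f a ≤ g a + c) → ∑ n f ≤ ∑ n g + n * c
∑-mono-≤-+ n {f} {g} c f≤g+c = begin
  ∑ n f                        ≤⟨ ∑-mono-≤ n f≤g+c ⟩
  ∑ n (λ a → g a + c)          ≡⟨ ∑-distrib-+ n g (λ _ → c) ⟩
  ∑ n g + ∑ n (λ _ → c)        ≡⟨ cong (∑ n g +_) (∑-const n c) ⟩
  ∑ n g + n * c                ∎
  where open ≤-Reasoning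

∑-*-distribʳ : ∀ n f p → ∑ n f * p ≡ ∑ n (λ a → f a * p)
∑-*-distribʳ zero    f p = refl
∑-*-distribʳ (suc n) f p = trans (*-distribʳ-+ p (f 0) _) (cong (f 0 * p +_) (∑-*-distribʳ n (λ a → f (suc a)) p))

-- Both sides are the total of g over the distances from r to 0, 1, …, n.
∑-recentre : ∀ n r (g : ℕ → ℕ) → ∑ n (λ a → g ∣ a - r ∣) + g ∣ n - r ∣ ≡ ∑ n (λ a → g ∣ suc a - r ∣) + g r
∑-recentre n r g = begin
  ∑ n (λ a → g ∣ a - r ∣) + g ∣ n - r ∣     ≡⟨ ∑-last n (λ a → g ∣ a - r ∣) ⟨
  ∑ (suc n) (λ a → g ∣ a - r ∣)           ≡⟨ +-comm (g r) (∑ n (λ a → g ∣ suc a - r ∣)) ⟩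
  ∑ n (λ a → g ∣ suc a - r ∣) + g r        ∎
  where open ≡-Reasoning

∑-recentre-≤ : ∀ n r (g : ℕ → ℕ) {c} → g ∣ n - r ∣ ≤ c + g r →
  ∑ n (λ a → g ∣ suc a - r ∣) ≤ c + ∑ n (λ a → g ∣ a - r ∣)
∑-recentre-≤ n r g {c} far≤ = +-cancelʳ-≤ (g r) _ _ (begin
  ∑ n (λ a → g ∣ suc a - r ∣) + g r        ≡⟨ ∑-recentre n r g ⟨
  ∑ n (λ a → g ∣ a - r ∣) + g ∣ n - r ∣     ≤⟨ +-monoʳ-≤ (∑ n (λ a → g ∣ a - r ∣)) far≤ ⟩
  ∑ n (λ a → g ∣ a - r ∣) + (c + g r)       ≡⟨ regroup (∑ n (λ a → g ∣ a - r ∣)) c (g r) ⟩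
  c + ∑ n (λ a → g ∣ a - r ∣) + g r         ∎)
  where
  open ≤-Reasoning
  regroup : ∀ x y z → x + (y + z) ≡ y + x + z
  regroup = solve-∀

∑-recentre-≥ : ∀ n r (g : ℕ → ℕ) {c} → c + g r ≤ g ∣ n - r ∣ →
  c + ∑ n (λ a → g ∣ a - r ∣) ≤ ∑ n (λ a → g ∣ suc a - r ∣)
∑-recentre-≥ n r g {c} ≤far = +-cancelʳ-≤ (g r) _ _ (begin
  c + ∑ n (λ a → g ∣ a - r ∣) + g r         ≡⟨ regroup c (∑ n (λ a → g ∣ a - r ∣)) (g r) ⟩
  ∑ n (λ a → g ∣ a - r ∣) + (c + g r)       ≤⟨ +-monoʳ-≤ (∑ n (λ a → g ∣ a - r ∣)) ≤far ⟩
  ∑ n (λ a → g ∣ a - r ∣) + g ∣ n - r ∣     ≡⟨ ∑-recentre n r g ⟩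
  ∑ n (λ a → g ∣ suc a - r ∣) + g r        ∎)
  where
  open ≤-Reasoning
  regroup : ∀ x y z → x + y + z ≡ y + (x + z)
  regroup = solve-∀

-- The cost of a vertex

lower-map-range1 : ∀ k (f : ℕ → ℕ × ℕ) n → lower k (map f (range1 n)) ≡ ∑ n (λ a → approx k (f (suc a)))
lower-map-range1 k f n = go n (λ a → a)
  where
  go : ∀ n (φ : ℕ → ℕ) → lower k (map f (map suc (applyUpTo φ n))) ≡ ∑ n (λ a → approx k (f (suc (φ a))))
  go zero    φ = refl
  go (suc n) φ = trans (lower-∷ k (f (suc (φ 0))) (map f (map suc (applyUpTo (λ a → φ (suc a)) n))))
                       (cong (approx k (f (suc (φ 0))) +_) (go n (λ a → φ (suc a))))

lower-map-concatMap-range1 : ∀ k (f : Vertex → ℕ × ℕ) (h : ℕ → List Vertex) n →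
  lower k (map f (concatMap h (range1 n))) ≡ ∑ n (λ a → lower k (map f (h (suc a))))
lower-map-concatMap-range1 k f h n = go n (λ a → a)
  where
  go : ∀ n (φ : ℕ → ℕ) →
    lower k (map f (concatMap h (map suc (applyUpTo φ n)))) ≡ ∑ n (λ a → lower k (map f (h (suc (φ a)))))
  go zero    φ = refl
  go (suc n) φ = begin
    lower k (map f (first ++ rest))              ≡⟨ cong (lower k) (map-++ f first rest) ⟩
    lower k (map f first ++ map f rest)          ≡⟨ lower-++ k (map f first) (map f rest) ⟩
    lower k (map f first) + lower k (map f rest) ≡⟨ cong (lower k (map f first) +_) (go n (λ a → φ (suc a))) ⟩
    lower k (map f first) + ∑ n (λ a → lower k (map f (h (suc (φ (suc a)))))) ∎
    where
    open ≡-Reasoning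
    first rest : List Vertex
    first = h (suc (φ 0))
    rest  = concatMap h (map suc (applyUpTo (λ a → φ (suc a)) n))

-- dist depends on the two rows only through their difference t, so a row offset t is encoded by the rows 0 and t.
rowCost : ℕ → ℕ → ℕ → ℕ → ℕ → ℕ
rowCost k K C t i = ∑ C (λ b → approx k (dist K (0 , suc b) (t , i)))

halfCost : ℕ → ℕ → ℕ → ℕ → Vertex → ℕ
halfCost k R C K (r , i) = ∑ R (λ a → rowCost k K C ∣ suc a - r ∣ i)

lower-cost : ∀ k R C K u → lower k (cost R C K u) ≡ halfCost k R C K u + halfCost k R C K u
lower-cost k R C K (r , i) = trans (lower-++ k xs xs) (cong₂ _+_ lower-xs lower-xs)
  where
  f : Vertex → ℕ × ℕ
  f v = dist K v (r , i)
  row : ℕ → List Vertex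
  row a = map (λ c → (a , c)) (range1 C)
  xs : SqrtSum
  xs = map f (vertices R C)
  lower-xs : lower k xs ≡ halfCost k R C K (r , i)
  lower-xs = trans (lower-map-concatMap-range1 k f row R) (∑-cong R λ a _ →
    trans (cong (lower k) (sym (map-∘ (range1 C)))) (lower-map-range1 k (λ c → f (suc a , c)) C))

hyp-zero : ∀ k t → hyp (t * t) (4 ^ k) 0 ≡ t * 2 ^ k
hyp-zero k t = trans (cong isqrt square) (isqrt[m*m]≡m (t * 2 ^ k))
  where
  square : (t * t + 0) * 4 ^ k ≡ t * 2 ^ k * (t * 2 ^ k)
  square = trans (cong₂ _*_ (+-identityʳ (t * t)) (4^k≡2^k*2^k k)) (interchange t (2 ^ k))
    where
    interchange : ∀ x y → x * x * (y * y) ≡ x * y * (x * y)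
    interchange = solve-∀

-- The letters place column c, then column i, in E (≤ K) or M (≥ K); on the border column K both
-- clauses of dist apply and agree, which is what the cases c ≡ K and i ≡ K below check.
approx-dist-EE : ∀ k K t {c i} → c ≤ K → i ≤ K →
  approx k (dist K (0 , c) (t , i)) ≡ hyp (t * t) (4 ^ k) ∣ c - i ∣
approx-dist-EE k K t {c} {i} c≤K i≤K with c ≤? K | i ≤? K
... | yes _  | yes _  = +-identityʳ _
... | no c≰K | _      = contradiction c≤K c≰K
... | yes _  | no i≰K = contradiction i≤K i≰K

approx-dist-ME : ∀ k K t {c i} → K < c → i ≤ K →
  approx k (dist K (0 , c) (t , i)) ≡ hyp (t * t) (4 ^ k) ∣ K - i ∣ + ∣ c - K ∣ * 2 ^ k
approx-dist-ME k K t {c} {i} K<c i≤K with c ≤? K | K ≤? c | K ≤? i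
... | yes c≤K | _     | _     = contradiction c≤K (<⇒≱ K<c)
... | no _    | no _  | _     = refl
... | no _    | yes _ | no _  = refl
... | no _    | yes _ | yes K≤i with ≤-antisym i≤K K≤i
...   | refl = trans (*-distribʳ-+ (2 ^ k) t ∣ c - i ∣)
                     (cong (_+ ∣ c - i ∣ * 2 ^ k) (sym (trans (cong (hyp (t * t) (4 ^ k)) (∣n-n∣≡0 i)) (hyp-zero k t))))

approx-dist-EM : ∀ k K t {c i} → c ≤ K → K ≤ i →
  approx k (dist K (0 , c) (t , i)) ≡ hyp (t * t) (4 ^ k) ∣ c - K ∣ + ∣ i - K ∣ * 2 ^ k
approx-dist-EM k K t {c} {i} c≤K K≤i with c ≤? K | i ≤? K
... | no c≰K | _       = contradiction c≤K c≰K
... | yes _  | yes i≤K with ≤-antisym i≤K K≤i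
...   | refl = sym (cong (λ z → hyp (t * t) (4 ^ k) ∣ c - i ∣ + z * 2 ^ k) (∣n-n∣≡0 i))
approx-dist-EM k K t {c} {i} c≤K K≤i | yes _ | no _ with K ≤? c | K ≤? i
... | _       | no K≰i = contradiction K≤i K≰i
... | no _    | yes _  = refl
... | yes K≤c | yes _  with ≤-antisym c≤K K≤c
...   | refl = trans (*-distribʳ-+ (2 ^ k) t ∣ c - i ∣)
                     (cong₂ (λ x y → x + y * 2 ^ k) (sym (trans (cong (hyp (t * t) (4 ^ k)) (∣n-n∣≡0 c)) (hyp-zero k t)))
                            (∣-∣-comm c i))

approx-dist-MM : ∀ k K t {c i} → K < c → K ≤ i → approx k (dist K (0 , c) (t , i)) ≡ (t + ∣ c - i ∣) * 2 ^ k
approx-dist-MM k K t {c} {i} K<c K≤i with c ≤? K | K ≤? c | K ≤? i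
... | yes c≤K | _      | _      = contradiction c≤K (<⇒≱ K<c)
... | no _    | no K≰c | _      = contradiction (<⇒≤ K<c) K≰c
... | no _    | yes _  | no K≰i = contradiction K≤i K≰i
... | no _    | yes _  | yes _  = refl

approx-monoˡ-≤ : ∀ k {t t′} x m → t ≤ t′ → approx k (t * t + x , m) ≤ approx k (t′ * t′ + x , m)
approx-monoˡ-≤ k x m t≤t′ =
  +-monoˡ-≤ (m * 2 ^ k) (isqrt-mono-≤ (*-monoˡ-≤ (4 ^ k) (+-monoˡ-≤ x (*-mono-≤ t≤t′ t≤t′))))

approx-dist-mono : ∀ k K {t t′} c i → t ≤ t′ → approx k (dist K (0 , c) (t , i)) ≤ approx k (dist K (0 , c) (t′ , i))
approx-dist-mono k K c i t≤t′ with c ≤? K | i ≤? K | K ≤? c | K ≤? i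
... | yes _ | yes _ | _     | _     = approx-monoˡ-≤ k _ 0 t≤t′
... | yes _ | no _  | yes _ | yes _ = *-monoˡ-≤ (2 ^ k) (+-monoˡ-≤ ∣ c - i ∣ t≤t′)
... | yes _ | no _  | yes _ | no _  = approx-monoˡ-≤ k _ ∣ i - K ∣ t≤t′
... | yes _ | no _  | no _  | _     = approx-monoˡ-≤ k _ ∣ i - K ∣ t≤t′
... | no _  | _     | yes _ | yes _ = *-monoˡ-≤ (2 ^ k) (+-monoˡ-≤ ∣ c - i ∣ t≤t′)
... | no _  | _     | yes _ | no _  = approx-monoˡ-≤ k _ ∣ c - K ∣ t≤t′
... | no _  | _     | no _  | _     = approx-monoˡ-≤ k _ ∣ c - K ∣ t≤t′

rowCost-E : ∀ k K n t {i} → i ≤ K →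
  rowCost k K (K + n) t i ≡
  ∑ K (λ b → hyp (t * t) (4 ^ k) ∣ suc b - i ∣) + n * hyp (t * t) (4 ^ k) ∣ K - i ∣ + ∑ n (λ a → suc a * 2 ^ k)
rowCost-E k K n t {i} i≤K = begin
  rowCost k K (K + n) t i
    ≡⟨ ∑-+ K n column ⟩
  ∑ K column + ∑ n (λ a → column (K + a))
    ≡⟨ cong₂ _+_ (∑-cong K λ b b<K → approx-dist-EE k K t b<K i≤K) (∑-cong n λ a _ → manhattan a) ⟩
  ∑ K (λ b → h ∣ suc b - i ∣) + ∑ n (λ a → h ∣ K - i ∣ + suc a * 2 ^ k)
    ≡⟨ cong (∑ K (λ b → h ∣ suc b - i ∣) +_) (∑-distrib-+ n (λ _ → h ∣ K - i ∣) (λ a → suc a * 2 ^ k)) ⟩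
  ∑ K (λ b → h ∣ suc b - i ∣) + (∑ n (λ _ → h ∣ K - i ∣) + ∑ n (λ a → suc a * 2 ^ k))
    ≡⟨ cong (λ z → ∑ K (λ b → h ∣ suc b - i ∣) + (z + ∑ n (λ a → suc a * 2 ^ k))) (∑-const n (h ∣ K - i ∣)) ⟩
  ∑ K (λ b → h ∣ suc b - i ∣) + (n * h ∣ K - i ∣ + ∑ n (λ a → suc a * 2 ^ k))
    ≡⟨ +-assoc (∑ K (λ b → h ∣ suc b - i ∣)) _ _ ⟨
  ∑ K (λ b → h ∣ suc b - i ∣) + n * h ∣ K - i ∣ + ∑ n (λ a → suc a * 2 ^ k) ∎
  where
  open ≡-Reasoning
  h : ℕ → ℕ
  h = hyp (t * t) (4 ^ k)
  column : ℕ → ℕ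
  column b = approx k (dist K (0 , suc b) (t , i))
  manhattan : ∀ a → column (K + a) ≡ h ∣ K - i ∣ + suc a * 2 ^ k
  manhattan a = trans (approx-dist-ME k K t (s≤s (m≤m+n K a)) i≤K)
                      (cong (λ z → h ∣ K - i ∣ + z * 2 ^ k) (∣1+m+n-m∣≡1+n K a))

rowCost-M : ∀ k K n t r →
  rowCost k K (K + n) t (K + r) ≡
  ∑ K (λ b → hyp (t * t) (4 ^ k) ∣ suc b - K ∣) + (K * r + ∑ n (λ a → t + ∣ suc a - r ∣)) * 2 ^ k
rowCost-M k K n t r = begin
  rowCost k K (K + n) t (K + r)
    ≡⟨ ∑-+ K n column ⟩
  ∑ K column + ∑ n (λ a → column (K + a))
    ≡⟨ cong₂ _+_ (∑-cong K λ b b<K → euclidean b b<K) (∑-cong n λ a _ → manhattan a) ⟩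
  ∑ K (λ b → h ∣ suc b - K ∣ + r * p) + ∑ n (λ a → (t + ∣ suc a - r ∣) * p)
    ≡⟨ cong₂ _+_ (∑-distrib-+ K (λ b → h ∣ suc b - K ∣) (λ _ → r * p))
                 (sym (∑-*-distribʳ n (λ a → t + ∣ suc a - r ∣) p)) ⟩
  ∑ K (λ b → h ∣ suc b - K ∣) + ∑ K (λ _ → r * p) + ∑ n (λ a → t + ∣ suc a - r ∣) * p
    ≡⟨ cong (λ z → ∑ K (λ b → h ∣ suc b - K ∣) + z + ∑ n (λ a → t + ∣ suc a - r ∣) * p) (∑-const K (r * p)) ⟩
  ∑ K (λ b → h ∣ suc b - K ∣) + K * (r * p) + ∑ n (λ a → t + ∣ suc a - r ∣) * p
    ≡⟨ factor (∑ K (λ b → h ∣ suc b - K ∣)) K r (∑ n (λ a → t + ∣ suc a - r ∣)) p ⟩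
  ∑ K (λ b → h ∣ suc b - K ∣) + (K * r + ∑ n (λ a → t + ∣ suc a - r ∣)) * p ∎
  where
  open ≡-Reasoning
  h : ℕ → ℕ
  h = hyp (t * t) (4 ^ k)
  p : ℕ
  p = 2 ^ k
  column : ℕ → ℕ
  column b = approx k (dist K (0 , suc b) (t , K + r))
  euclidean : ∀ b → b < K → column b ≡ h ∣ suc b - K ∣ + r * p
  euclidean b b<K = trans (approx-dist-EM k K t b<K (m≤m+n K r))
                          (cong (λ z → h ∣ suc b - K ∣ + z * p) (∣m+n-m∣≡n K r))
  manhattan : ∀ a → column (K + a) ≡ (t + ∣ suc a - r ∣) * p
  manhattan a = trans (approx-dist-MM k K t (s≤s (m≤m+n K a)) (m≤m+n K r))
                      (cong (λ z → (t + z) * p) (trans (cong (∣_- K + r ∣) (sym (+-suc K a))) (∣m+n-m+o∣≡∣n-o∣ K (suc a) r)))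
  factor : ∀ x K r y p → x + K * (r * p) + y * p ≡ x + (K * r + y) * p
  factor = solve-∀

rowCost-E-dec : ∀ k K n t {i} → i + i < K → rowCost k K (K + n) t (suc i) ≤ rowCost k K (K + n) t i
rowCost-E-dec k K n t {i} 2i<K = begin
  rowCost k K (K + n) t (suc i)                                        ≡⟨ rowCost-E k K n t i<K ⟩
  ∑ K (λ b → h ∣ b - i ∣) + n * h ∣ K - suc i ∣ + M
    ≤⟨ +-monoˡ-≤ M (+-mono-≤ (∑-recentre-≥ K i h (hyp-mono-≤ (t * t) (4 ^ k) (o+n≤m⇒o≤∣m-n∣ (<⇒≤ 2i<K))))
                             (*-monoʳ-≤ n (hyp-mono-≤ (t * t) (4 ^ k) (∣m-1+n∣≤∣m-n∣ i<K)))) ⟩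
  ∑ K (λ b → h ∣ suc b - i ∣) + n * h ∣ K - i ∣ + M                     ≡⟨ rowCost-E k K n t (<⇒≤ i<K) ⟨
  rowCost k K (K + n) t i                                              ∎
  where
  open ≤-Reasoning
  h : ℕ → ℕ
  h = hyp (t * t) (4 ^ k)
  M : ℕ
  M = ∑ n (λ a → suc a * 2 ^ k)
  i<K : i < K
  i<K = ≤-<-trans (m≤m+n i i) 2i<K

-- With K = i + 1 + s, the step from i to i + 1 saves the n Manhattan columns n (h (s + 1) − h s) and
-- costs the Euclidean columns h i − h (s + 1); as i ≥ n + 1 + s, convexity of h makes the cost at least
-- the saving, up to rounding.
rowCost-E-inc : ∀ k K n t {i} → i < K → K + n ≤ i + i →
  rowCost k K (K + n) t i ≤ rowCost k K (K + n) t (suc i) + 2 * n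
rowCost-E-inc k K n t {i} i<K K+n≤2i with K ∸ suc i | m+[n∸m]≡n i<K
... | s | refl = +-cancelʳ-≤ (h i) _ _ (begin
  rowCost k K (K + n) t i + h i
    ≡⟨ cong (_+ h i) (rowCost-E k K n t (<⇒≤ i<K)) ⟩
  E i + n * h ∣ K - i ∣ + M + h i
    ≡⟨ cong (λ z → E i + n * h z + M + h i) ∣K-i∣≡1+s ⟩
  E i + n * h (suc s) + M + h i
    ≡⟨ regroup₁ (E i) (n * h (suc s)) M (h i) ⟩
  E i + h i + n * h (suc s) + M
    ≡⟨ cong (λ z → z + n * h (suc s) + M) (∑-recentre K i h) ⟨
  E (suc i) + h ∣ K - i ∣ + n * h (suc s) + M
    ≡⟨ cong (λ z → E (suc i) + h z + n * h (suc s) + M) ∣K-i∣≡1+s ⟩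
  E (suc i) + h (suc s) + n * h (suc s) + M
    ≡⟨ regroup₂ (E (suc i)) (h (suc s)) (n * h (suc s)) M ⟩
  E (suc i) + M + (n * h (suc s) + h (1 + s))
    ≤⟨ +-monoʳ-≤ (E (suc i) + M) (hyp-convex-iterated (t * t) (4 ^ k) n s 1) ⟩
  E (suc i) + M + (n * h s + h (n + 1 + s) + 2 * n)
    ≤⟨ +-monoʳ-≤ (E (suc i) + M) (+-monoˡ-≤ (2 * n) (+-monoʳ-≤ (n * h s) (hyp-mono-≤ (t * t) (4 ^ k) n+1+s≤i))) ⟩
  E (suc i) + M + (n * h s + h i + 2 * n)
    ≡⟨ regroup₃ (E (suc i)) M (n * h s) (h i) (2 * n) ⟩
  E (suc i) + n * h s + M + 2 * n + h i
    ≡⟨ cong (λ z → E (suc i) + n * h z + M + 2 * n + h i) ∣K-1-i∣≡s ⟨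
  E (suc i) + n * h ∣ K - suc i ∣ + M + 2 * n + h i
    ≡⟨ cong (λ z → z + 2 * n + h i) (rowCost-E k K n t i<K) ⟨
  rowCost k K (K + n) t (suc i) + 2 * n + h i ∎)
  where
  open ≤-Reasoning
  h : ℕ → ℕ
  h = hyp (t * t) (4 ^ k)
  E : ℕ → ℕ
  E j = ∑ (suc i + s) (λ b → h ∣ suc b - j ∣)
  M : ℕ
  M = ∑ n (λ a → suc a * 2 ^ k)
  ∣K-i∣≡1+s : ∣ suc i + s - i ∣ ≡ suc s
  ∣K-i∣≡1+s = ∣1+m+n-m∣≡1+n i s
  ∣K-1-i∣≡s : ∣ suc i + s - suc i ∣ ≡ s
  ∣K-1-i∣≡s = ∣m+n-m∣≡n (suc i) s
  n+1+s≤i : n + 1 + s ≤ i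
  n+1+s≤i = +-cancelˡ-≤ i _ _ (subst (_≤ i + i) (regroup i s n) K+n≤2i)
    where
    regroup : ∀ i s n → suc i + s + n ≡ i + (n + 1 + s)
    regroup = solve-∀
  regroup₁ : ∀ x y z w → x + y + z + w ≡ x + w + y + z
  regroup₁ = solve-∀
  regroup₂ : ∀ x y z w → x + y + z + w ≡ x + w + (z + y)
  regroup₂ = solve-∀
  regroup₃ : ∀ x y z w v → x + y + (z + w + v) ≡ x + z + y + v + w
  regroup₃ = solve-∀

rowCost-M-inc : ∀ k K n t {i} → K ≤ i → K + n ≤ i + i → rowCost k K (K + n) t i ≤ rowCost k K (K + n) t (suc i)
rowCost-M-inc k K n t {i} K≤i K+n≤2i with i ∸ K | m+[n∸m]≡n K≤i
... | r | refl = begin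
  rowCost k K (K + n) t (K + r)        ≡⟨ rowCost-M k K n t r ⟩
  Eb + (K * r + Y r) * 2 ^ k           ≤⟨ +-monoʳ-≤ Eb (*-monoˡ-≤ (2 ^ k) D≤D′) ⟩
  Eb + (K * suc r + Y (suc r)) * 2 ^ k ≡⟨ rowCost-M k K n t (suc r) ⟨
  rowCost k K (K + n) t (K + suc r)    ≡⟨ cong (rowCost k K (K + n) t) (+-suc K r) ⟩
  rowCost k K (K + n) t (suc (K + r))  ∎
  where
  open ≤-Reasoning
  n≤K+2r : n ≤ K + (r + r)
  n≤K+2r = +-cancelˡ-≤ K _ _ (≤-trans K+n≤2i (≤-reflexive (regroup K r)))
    where
    regroup : ∀ K r → K + r + (K + r) ≡ K + (K + (r + r))
    regroup = solve-∀
  Eb : ℕ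
  Eb = ∑ K (λ b → hyp (t * t) (4 ^ k) ∣ suc b - K ∣)
  Y : ℕ → ℕ
  Y r = ∑ n (λ a → t + ∣ suc a - r ∣)
  far≤ : t + ∣ n - r ∣ ≤ K + (t + r)
  far≤ = begin
    t + ∣ n - r ∣   ≤⟨ +-monoʳ-≤ t (∣m-n∣≤o (≤-trans n≤K+2r (≤-reflexive (sym (+-assoc K r r))))
                                          (≤-trans (m≤n+m r K) (m≤m+n (K + r) n))) ⟩
    t + (K + r)     ≡⟨ +-assoc t K r ⟨
    t + K + r       ≡⟨ cong (_+ r) (+-comm t K) ⟩
    K + t + r       ≡⟨ +-assoc K t r ⟩
    K + (t + r)     ∎
  D≤D′ : K * r + Y r ≤ K * suc r + Y (suc r)
  D≤D′ = begin
    K * r + Y r                ≤⟨ +-monoʳ-≤ (K * r) (∑-recentre-≤ n r (t +_) far≤) ⟩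
    K * r + (K + Y (suc r))    ≡⟨ +-assoc (K * r) K (Y (suc r)) ⟨
    K * r + K + Y (suc r)      ≡⟨ cong (_+ Y (suc r)) (trans (+-comm (K * r) K) (sym (*-suc K r))) ⟩
    K * suc r + Y (suc r)      ∎

rowCost-M-dec : ∀ k K n t {i} → K ≤ i → i + i < K + n → rowCost k K (K + n) t (suc i) ≤ rowCost k K (K + n) t i
rowCost-M-dec k K n t {i} K≤i 2i<K+n with i ∸ K | m+[n∸m]≡n K≤i
... | r | refl = begin
  rowCost k K (K + n) t (suc (K + r))  ≡⟨ cong (rowCost k K (K + n) t) (+-suc K r) ⟨
  rowCost k K (K + n) t (K + suc r)    ≡⟨ rowCost-M k K n t (suc r) ⟩
  Eb + (K * suc r + Y (suc r)) * 2 ^ k ≤⟨ +-monoʳ-≤ Eb (*-monoˡ-≤ (2 ^ k) D′≤D) ⟩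
  Eb + (K * r + Y r) * 2 ^ k           ≡⟨ rowCost-M k K n t r ⟨
  rowCost k K (K + n) t (K + r)        ∎
  where
  open ≤-Reasoning
  K+2r<n : K + (r + r) < n
  K+2r<n = +-cancelˡ-< K _ _ (≤-trans (≤-reflexive (regroup K r)) 2i<K+n)
    where
    regroup : ∀ K r → suc (K + (K + (r + r))) ≡ suc (K + r + (K + r))
    regroup = solve-∀
  Eb : ℕ
  Eb = ∑ K (λ b → hyp (t * t) (4 ^ k) ∣ suc b - K ∣)
  Y : ℕ → ℕ
  Y r = ∑ n (λ a → t + ∣ suc a - r ∣)
  ≤far : K + (t + r) ≤ t + ∣ n - r ∣
  ≤far = begin
    K + (t + r)     ≡⟨ +-assoc K t r ⟨
    K + t + r       ≡⟨ cong (_+ r) (+-comm K t) ⟩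
    t + K + r       ≡⟨ +-assoc t K r ⟩
    t + (K + r)     ≤⟨ +-monoʳ-≤ t (o+n≤m⇒o≤∣m-n∣ (≤-trans (≤-reflexive (+-assoc K r r)) (<⇒≤ K+2r<n))) ⟩
    t + ∣ n - r ∣   ∎
  D′≤D : K * suc r + Y (suc r) ≤ K * r + Y r
  D′≤D = begin
    K * suc r + Y (suc r)      ≡⟨ cong (_+ Y (suc r)) (trans (*-suc K r) (+-comm K (K * r))) ⟩
    K * r + K + Y (suc r)      ≡⟨ +-assoc (K * r) K (Y (suc r)) ⟩
    K * r + (K + Y (suc r))    ≤⟨ +-monoʳ-≤ (K * r) (∑-recentre-≥ n r (t +_) ≤far) ⟩
    K * r + Y r                ∎

rowCost-mono : ∀ k K C {t t′} i → t ≤ t′ → rowCost k K C t i ≤ rowCost k K C t′ i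
rowCost-mono k K C i t≤t′ = ∑-mono-≤ C λ b _ → approx-dist-mono k K (suc b) i t≤t′

halfCost-row-inc : ∀ k R C K {r} i → R ≤ r + r → halfCost k R C K (r , i) ≤ halfCost k R C K (suc r , i)
halfCost-row-inc k R C K {r} i R≤2r =
  ∑-recentre-≤ R r (λ t → rowCost k K C t i) (rowCost-mono k K C i (∣m-n∣≤o R≤2r (m≤m+n r R)))

halfCost-row-dec : ∀ k R C K {r} i → r + r ≤ R → halfCost k R C K (suc r , i) ≤ halfCost k R C K (r , i)
halfCost-row-dec k R C K {r} i 2r≤R =
  ∑-recentre-≥ R r (λ t → rowCost k K C t i) (rowCost-mono k K C i (o+n≤m⇒o≤∣m-n∣ 2r≤R))

cost-≼ : ∀ R C K {u v} s → (∀ k → halfCost k R C K u ≤ halfCost k R C K v + s) → cost R C K u ≼ cost R C K v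
cost-≼ R C K {u} {v} s half≤ = within (s + s) λ k → begin
  lower k (cost R C K u)               ≡⟨ lower-cost k R C K u ⟩
  H k u + H k u                        ≤⟨ +-mono-≤ (half≤ k) (half≤ k) ⟩
  H k v + s + (H k v + s)              ≡⟨ interchange (H k v) s ⟩
  H k v + H k v + (s + s)              ≡⟨ cong (_+ (s + s)) (lower-cost k R C K v) ⟨
  lower k (cost R C K v) + (s + s)     ∎
  where
  open ≤-Reasoning
  H : ℕ → Vertex → ℕ
  H k w = halfCost k R C K w
  interchange : ∀ x y → x + y + (x + y) ≡ x + x + (y + y)
  interchange = solve-∀

cost-≼-column : ∀ R C K r {i j} s → (∀ k t → rowCost k K C t i ≤ rowCost k K C t j + s) →
  cost R C K (r , i) ≼ cost R C K (r , j)
cost-≼-column R C K r s row≤ = cost-≼ R C K (R * s) λ k → ∑-mono-≤-+ R s λ a _ → row≤ k ∣ suc a - r ∣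

≼-chain-up : ∀ (F : ℕ → SqrtSum) {m n} → m ≤ n → (∀ r → m ≤ r → r < n → F r ≼ F (suc r)) → F m ≼ F n
≼-chain-up F {n = zero}  z≤n   step = ≼-refl
≼-chain-up F {n = suc n} m≤1+n step with m≤n⇒m<n∨m≡n m≤1+n
... | inj₂ refl  = ≼-refl
... | inj₁ m<1+n = ≼-trans (≼-chain-up F (s≤s⁻¹ m<1+n) λ r m≤r r<n → step r m≤r (m<n⇒m<1+n r<n))
                           (step n (s≤s⁻¹ m<1+n) ≤-refl)

≼-chain-down : ∀ (F : ℕ → SqrtSum) {m n} → m ≤ n → (∀ r → m ≤ r → r < n → F (suc r) ≼ F r) → F n ≼ F m
≼-chain-down F {n = zero}  z≤n   step = ≼-refl
≼-chain-down F {n = suc n} m≤1+n step with m≤n⇒m<n∨m≡n m≤1+n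
... | inj₂ refl  = ≼-refl
... | inj₁ m<1+n = ≼-trans (step n (s≤s⁻¹ m<1+n) ≤-refl)
                           (≼-chain-down F (s≤s⁻¹ m<1+n) λ r m≤r r<n → step r m≤r (m<n⇒m<1+n r<n))

-- The median

⌈n/2⌉≤m⇒n≤m+m : ∀ {m} n → ⌈ n /2⌉ ≤ m → n ≤ m + m
⌈n/2⌉≤m⇒n≤m+m {m} n ⌈n/2⌉≤m = ≤-trans (n≤2⌈n/2⌉ n) (+-mono-≤ ⌈n/2⌉≤m ⌈n/2⌉≤m)
  where
  n≤2⌈n/2⌉ : ∀ n → n ≤ ⌈ n /2⌉ + ⌈ n /2⌉
  n≤2⌈n/2⌉ zero          = z≤n
  n≤2⌈n/2⌉ (suc zero)    = s≤s z≤n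
  n≤2⌈n/2⌉ (suc (suc n)) = s≤s (≤-trans (s≤s (n≤2⌈n/2⌉ n)) (≤-reflexive (sym (+-suc ⌈ n /2⌉ ⌈ n /2⌉))))

m<⌈n/2⌉⇒m+m<n : ∀ {m} n → m < ⌈ n /2⌉ → m + m < n
m<⌈n/2⌉⇒m+m<n {zero}  (suc n)       _             = z<s
m<⌈n/2⌉⇒m+m<n {suc m} (suc (suc n)) (s≤s m<⌈n/2⌉) =
  s≤s (subst (_< suc n) (sym (+-suc m m)) (s≤s (m<⌈n/2⌉⇒m+m<n n m<⌈n/2⌉)))

0<n⇒0<⌈n/2⌉ : ∀ {n} → 0 < n → 0 < ⌈ n /2⌉
0<n⇒0<⌈n/2⌉ {suc zero}    _ = z<s
0<n⇒0<⌈n/2⌉ {suc (suc n)} _ = z<s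

module ColumnProfile (R K n : ℕ) where

  𝒞̄ : ℕ → SqrtSum
  𝒞̄ = costBar R (K + n) K

  𝒞̄-E-dec : ∀ {i} → i + i < K → 𝒞̄ (suc i) ≼ 𝒞̄ i
  𝒞̄-E-dec 2i<K = cost-≼-column R (K + n) K ⌈ R /2⌉ 0 λ k t → m≤n⇒m≤n+o 0 (rowCost-E-dec k K n t 2i<K)

  𝒞̄-E-inc : ∀ {i} → i < K → K + n ≤ i + i → 𝒞̄ i ≼ 𝒞̄ (suc i)
  𝒞̄-E-inc i<K K+n≤2i = cost-≼-column R (K + n) K ⌈ R /2⌉ (2 * n) λ k t → rowCost-E-inc k K n t i<K K+n≤2i

  𝒞̄-M-inc : ∀ {i} → K ≤ i → K + n ≤ i + i → 𝒞̄ i ≼ 𝒞̄ (suc i)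
  𝒞̄-M-inc K≤i K+n≤2i = cost-≼-column R (K + n) K ⌈ R /2⌉ 0 λ k t → m≤n⇒m≤n+o 0 (rowCost-M-inc k K n t K≤i K+n≤2i)

  𝒞̄-M-dec : ∀ {i} → K ≤ i → i + i < K + n → 𝒞̄ (suc i) ≼ 𝒞̄ i
  𝒞̄-M-dec K≤i 2i<K+n = cost-≼-column R (K + n) K ⌈ R /2⌉ 0 λ k t → m≤n⇒m≤n+o 0 (rowCost-M-dec k K n t K≤i 2i<K+n)

  𝒞̄-dec-to-⌈K/2⌉ : ∀ {j} → j ≤ ⌈ K /2⌉ → 𝒞̄ ⌈ K /2⌉ ≼ 𝒞̄ j
  𝒞̄-dec-to-⌈K/2⌉ j≤ = ≼-chain-down 𝒞̄ j≤ λ r _ r< → 𝒞̄-E-dec (m<⌈n/2⌉⇒m+m<n K r<)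

  𝒞̄-dec-to-⌈C/2⌉ : ∀ {j} → K ≤ j → j ≤ ⌈ K + n /2⌉ → 𝒞̄ ⌈ K + n /2⌉ ≼ 𝒞̄ j
  𝒞̄-dec-to-⌈C/2⌉ K≤j j≤ = ≼-chain-down 𝒞̄ j≤ λ r j≤r r< → 𝒞̄-M-dec (≤-trans K≤j j≤r) (m<⌈n/2⌉⇒m+m<n (K + n) r<)

  𝒞̄-inc-in-E : ∀ {j} → ⌈ K + n /2⌉ ≤ j → j ≤ K → 𝒞̄ ⌈ K + n /2⌉ ≼ 𝒞̄ j
  𝒞̄-inc-in-E ≤j j≤K = ≼-chain-up 𝒞̄ ≤j λ r ≤r r<j → 𝒞̄-E-inc (<-≤-trans r<j j≤K) (⌈n/2⌉≤m⇒n≤m+m (K + n) ≤r)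

  𝒞̄-inc-in-M : ∀ {m j} → K ≤ m → K + n ≤ m + m → m ≤ j → 𝒞̄ m ≼ 𝒞̄ j
  𝒞̄-inc-in-M K≤m K+n≤2m m≤j = ≼-chain-up 𝒞̄ m≤j λ r m≤r _ → 𝒞̄-M-inc (≤-trans K≤m m≤r) (≤-trans K+n≤2m (+-mono-≤ m≤r m≤r))

  argmin-≼ : ∀ {lo hi c} → IsArgMin R (K + n) K lo hi c → ∀ {i} → lo ≤ i → i ≤ hi → 𝒞̄ c ≼ 𝒞̄ i
  argmin-≼ (_ , minimal) lo≤i i≤hi = ≤ʳ⇒≼ (minimal _ lo≤i i≤hi)

  minimal-if-K≤⌈C/2⌉ : ∀ {c X} → IsArgMin R (K + n) K ⌈ K /2⌉ K c → K ≤ ⌈ K + n /2⌉ →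
    𝒞̄ X ≼ 𝒞̄ c → 𝒞̄ X ≼ 𝒞̄ ⌈ K + n /2⌉ → ∀ j → 𝒞̄ X ≼ 𝒞̄ j
  minimal-if-K≤⌈C/2⌉ c-min K≤Cb X≼c X≼Cb j with ≤-total j ⌈ K /2⌉ | ≤-total j K | ≤-total j ⌈ K + n /2⌉
  ... | inj₁ j≤Kb | _        | _        = ≼-trans X≼c (≼-trans (argmin-≼ c-min ≤-refl (⌈n/2⌉≤n K)) (𝒞̄-dec-to-⌈K/2⌉ j≤Kb))
  ... | inj₂ Kb≤j | inj₁ j≤K | _        = ≼-trans X≼c (argmin-≼ c-min Kb≤j j≤K)
  ... | inj₂ _    | inj₂ K≤j | inj₁ j≤Cb = ≼-trans X≼Cb (𝒞̄-dec-to-⌈C/2⌉ K≤j j≤Cb)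
  ... | inj₂ _    | inj₂ _   | inj₂ Cb≤j = ≼-trans X≼Cb (𝒞̄-inc-in-M K≤Cb (⌈n/2⌉≤m⇒n≤m+m (K + n) ≤-refl) Cb≤j)

  ⌈K/2⌉≤⌈C/2⌉ : ⌈ K /2⌉ ≤ ⌈ K + n /2⌉
  ⌈K/2⌉≤⌈C/2⌉ = ⌈n/2⌉-mono (m≤m+n K n)

  minimal-if-⌈C/2⌉<K : ∀ {c′} → IsArgMin R (K + n) K ⌈ K /2⌉ ⌈ K + n /2⌉ c′ → ⌈ K + n /2⌉ < K → ∀ j → 𝒞̄ c′ ≼ 𝒞̄ j
  minimal-if-⌈C/2⌉<K c′-min Cb<K j with ≤-total j ⌈ K /2⌉ | ≤-total j ⌈ K + n /2⌉ | ≤-total j K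
  ... | inj₁ j≤Kb | _         | _        = ≼-trans (argmin-≼ c′-min ≤-refl ⌈K/2⌉≤⌈C/2⌉) (𝒞̄-dec-to-⌈K/2⌉ j≤Kb)
  ... | inj₂ Kb≤j | inj₁ j≤Cb | _        = argmin-≼ c′-min Kb≤j j≤Cb
  ... | inj₂ _    | inj₂ Cb≤j | inj₁ j≤K = ≼-trans (argmin-≼ c′-min ⌈K/2⌉≤⌈C/2⌉ ≤-refl) (𝒞̄-inc-in-E Cb≤j j≤K)
  ... | inj₂ _    | inj₂ _    | inj₂ K≤j =
    ≼-trans (argmin-≼ c′-min ⌈K/2⌉≤⌈C/2⌉ ≤-refl)
      (≼-trans (𝒞̄-inc-in-E (<⇒≤ Cb<K) ≤-refl) (𝒞̄-inc-in-M ≤-refl (⌈n/2⌉≤m⇒n≤m+m (K + n) (<⇒≤ Cb<K)) K≤j))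

  𝒞̄-≼-cost : ∀ j r → 𝒞̄ j ≼ cost R (K + n) K (r , j)
  𝒞̄-≼-cost j r with ≤-total ⌈ R /2⌉ r
  ... | inj₁ Rb≤r = ≼-chain-up (λ x → cost R (K + n) K (x , j)) Rb≤r λ x Rb≤x _ →
    cost-≼ R (K + n) K 0 λ k → m≤n⇒m≤n+o 0 (halfCost-row-inc k R (K + n) K j (⌈n/2⌉≤m⇒n≤m+m R Rb≤x))
  ... | inj₂ r≤Rb = ≼-chain-down (λ x → cost R (K + n) K (x , j)) r≤Rb λ x _ x<Rb →
    cost-≼ R (K + n) K 0 λ k → m≤n⇒m≤n+o 0 (halfCost-row-dec k R (K + n) K j (<⇒≤ (m<⌈n/2⌉⇒m+m<n R x<Rb)))

  median : ∀ {X} → 0 < R → 0 < X → X ≤ K + n → (∀ j → 𝒞̄ X ≼ 𝒞̄ j) → IsMedian R (K + n) K (⌈ R /2⌉ , X)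
  median 0<R 0<X X≤C X-min =
    ((0<n⇒0<⌈n/2⌉ 0<R , ⌈n/2⌉≤n R) , (0<X , X≤C)) , λ { (r , j) _ → ≼⇒≤ʳ (≼-trans (X-min j) (𝒞̄-≼-cost j r)) }

theorem2 : (R C K : ℕ) → 1 ≤ R → 1 ≤ K → K ≤ C →
    (c c′ : ℕ) →
    IsArgMin R C K ⌈ K /2⌉ K c →
    IsArgMin R C K ⌈ K /2⌉ ⌈ C /2⌉ c′ →
    ((K ≤ ⌈ C /2⌉ → costBar R C K c <ʳ costBar R C K ⌈ C /2⌉ → IsMedian R C K (⌈ R /2⌉ , c))
    × (K ≤ ⌈ C /2⌉ → costBar R C K ⌈ C /2⌉ ≤ʳ costBar R C K c → IsMedian R C K (⌈ R /2⌉ , ⌈ C /2⌉))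
    × (⌈ C /2⌉ < K → IsMedian R C K (⌈ R /2⌉ , c′)))
theorem2 R C K 0<R 0<K K≤C with C ∸ K | m+[n∸m]≡n K≤C
... | n | refl = λ c c′ c-min c′-min →
    (λ K≤Cb c<Cb → median 0<R (0<c c-min) (≤-trans (proj₂ (proj₁ c-min)) (m≤m+n K n))
                          (minimal-if-K≤⌈C/2⌉ c-min K≤Cb ≼-refl (<ʳ⇒≼ c<Cb)))
  , (λ K≤Cb Cb≤c → median 0<R (0<n⇒0<⌈n/2⌉ (<-≤-trans 0<K (m≤m+n K n))) (⌈n/2⌉≤n (K + n))
                          (minimal-if-K≤⌈C/2⌉ c-min K≤Cb (≤ʳ⇒≼ Cb≤c) ≼-refl))
  , (λ Cb<K → median 0<R (0<c c′-min) (≤-trans (proj₂ (proj₁ c′-min)) (⌈n/2⌉≤n (K + n)))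
                      (minimal-if-⌈C/2⌉<K c′-min Cb<K))
  where
  open ColumnProfile R K n
  0<c : ∀ {hi c} → IsArgMin R (K + n) K ⌈ K /2⌉ hi c → 0 < c
  0<c ((Kb≤c , _) , _) = <-≤-trans (0<n⇒0<⌈n/2⌉ 0<K) Kb≤c
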